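{- For positive integers $m,n$ and every integer $r>1$, the sparing number of the $r$-th power of the complete bipartite graph $K_{m,n}$ is $\varphi(K_{m,n}^r)=\frac{1}{2}(m+n-1)(m+n-2)$.
   Context: All graphs are simple and finite. $\mathbb{N}_0$ denotes the set of non-negative integers. For non-empty $A,B\subseteq\mathbb{N}_0$, $A+B=\{a+b: a\in A, b\in B\}$. An integer additive set-indexer (IASI) of a graph $G$ is an injective function $f:V(G)\to\mathcal{P}(\mathbb{N}_0)$ with non-empty values such that the induced map $f^+(uv)=f(u)+f(v)$ on $E(G)$ is also injective. An IASI is weak if $|f^+(uv)|=\max(|f(u)|,|f(v)|)$ for every edge $uv$. An element (vertex or edge) is mono-indexed if its set-label has cardinality $1$. The sparing number $\varphi(H)$ of a graph $H$ is the minimum number of mono-indexed edges over all weak IASIs of $H$. The $r$-th power $G^r$ of $G$ has vertex set $V(G)$, two distinct vertices adjacent iff their distance in $G$ is at most $r$. -}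

module Defs where

open import Data.Nat using (ℕ; zero; suc; _+_; _≤_; _<_; _⊔_)
open import Data.Fin using (Fin; toℕ) renaming (_<_ to _<ᶠ_)
open import Data.List using (List; []; length)
open import Data.List.Membership.Propositional using (_∈_)
open import Data.List.Relation.Unary.Unique.Propositional using (Unique)
open import Data.Product using (Σ; _×_; ∃; ∃-syntax; _,_)
open import Data.Sum using (_⊎_)
open import Relation.Binary.PropositionalEquality using (_≡_; _≢_)
open import Relation.Nullary using (¬_)
open import Function.Bundles using (_⇔_)

HasCard : {A : Set} → (A → Set) → ℕ → Set
HasCard {A} S k =
  Σ (List A) λ L → Unique L × (∀ x → (x ∈ L) ⇔ S x) × length L ≡ k

-- Finite subsets of ℕ₀ (set-labels), given by a list; the set is the
-- set of members of the list.

FinSetℕ : Set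
FinSetℕ = List ℕ

⟦_⟧ : FinSetℕ → ℕ → Set
⟦ A ⟧ x = x ∈ A

SumSet : FinSetℕ → FinSetℕ → ℕ → Set
SumSet A B x = ∃[ a ] ∃[ b ] (a ∈ A × b ∈ B × x ≡ a + b)

Graph : ℕ → Set₁
Graph N = Fin N → Fin N → Set

data Walk {N : ℕ} (G : Graph N) : Fin N → Fin N → ℕ → Set where
  here : ∀ {i} → Walk G i i 0
  step : ∀ {i k j ℓ} → G i k → Walk G k j ℓ → Walk G i j (suc ℓ)

Power : {N : ℕ} → Graph N → ℕ → Graph N
Power G r i j = i ≢ j × ∃[ ℓ ] (ℓ ≤ r × Walk G i j ℓ)

K : (m n : ℕ) → Graph (m + n)
K m n i j = (toℕ i < m × m ≤ toℕ j) ⊎ (m ≤ toℕ i × toℕ j < m)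

-- an (unordered) edge is recorded as a pair (u , v) with u < v
IsEdge : {N : ℕ} → Graph N → Fin N × Fin N → Set
IsEdge G (u , v) = u <ᶠ v × G u v

record IASI {N : ℕ} (G : Graph N) (f : Fin N → FinSetℕ) : Set where
  field
    nonempty  : ∀ u → f u ≢ []
    injective : ∀ u v → (∀ x → ⟦ f u ⟧ x ⇔ ⟦ f v ⟧ x) → u ≡ v
    edge-injective : ∀ u v u′ v′ → G u v → G u′ v′ →
      (∀ x → SumSet (f u) (f v) x ⇔ SumSet (f u′) (f v′) x) →
      (u ≡ u′ × v ≡ v′) ⊎ (u ≡ v′ × v ≡ u′)

record WeakIASI {N : ℕ} (G : Graph N) (f : Fin N → FinSetℕ) : Set where
  field
    iasi : IASI G f
    weak : ∀ u v → G u v → ∀ a b c →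
      HasCard ⟦ f u ⟧ a → HasCard ⟦ f v ⟧ b → HasCard (SumSet (f u) (f v)) c →
      c ≡ a ⊔ b

MonoEdgeCount : {N : ℕ} → Graph N → (Fin N → FinSetℕ) → ℕ → Set
MonoEdgeCount G f k =
  HasCard (λ e → IsEdge G e × HasCard (SumSet (f (Data.Product.proj₁ e)) (f (Data.Product.proj₂ e))) 1) k

IsSparingNumber : {N : ℕ} → Graph N → ℕ → Set
IsSparingNumber {N} G k =
  (∃[ f ] (WeakIASI G f × MonoEdgeCount G f k)) ×
  (∀ (f : Fin N → FinSetℕ) → WeakIASI G f → ∀ k′ → MonoEdgeCount G f k′ → k ≤ k′)

module Submission where

-- For r ≥ 2 every two distinct vertices of K_{m,n} are at distance ≤ 2,
-- so K_{m,n}^r is the complete graph on N = m + n vertices, and the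
-- theorem says φ(K_N) = (N-1)(N-2)/2, the number of edges among N - 1
-- vertices.
--
-- If |A| ≥ 1 and B has two elements y₁ < y₂, then A + B
-- contains the |A| sums a + y₂ together with min A + y₁, so
-- |A + B| > |A|.  Hence in a weak IASI two adjacent vertices can not both
-- carry non-singleton labels; in a complete graph all vertices but one,
-- w, are mono-indexed, and every edge avoiding w is mono-indexed.
--
-- Label vertex 0 by {0, 1} and vertex u > 0 by {a u},
-- where a k = 2^k - 1 is a Sidon sequence.  Least elements of the labels
-- and of the sumsets determine the vertices and edges, the IASI is weak,
-- and exactly the edges avoiding vertex 0 are mono-indexed.

open import Defs
open import Data.Nat using (ℕ; zero; suc; _+_; _*_; _∸_; _≤_; _<_; _⊔_; z≤n; s≤s; _≟_; _<?_; _≤?_)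
open import Data.Nat.Properties
open import Data.Nat.DivMod using (_/_; m*n/n≡m)
open import Data.Fin using (Fin; toℕ; fromℕ<; punchIn) renaming (zero to fzero; suc to fsuc; _<_ to _<ᶠ_)
open import Data.Fin.Properties using (toℕ-injective; toℕ-fromℕ<; punchIn-injective; punchInᵢ≢i; punchIn-mono-≤; any?) renaming (suc-injective to fsuc-injective)
open import Data.List using (List; []; _∷_; length; map; _++_; deduplicate; cartesianProductWith; allFin)
open import Data.List.Properties using (length-map; length-++; length-tabulate; length-removeAt′)
open import Data.List.Membership.Propositional using (_∈_)
open import Data.List.Membership.Propositional.Properties
open import Data.List.Relation.Binary.Subset.Propositional using (_⊆_)
open import Data.List.Relation.Unary.Any using (here; there; index; _─_)
open import Data.List.Relation.Unary.All as All using ([]; _∷_)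
open import Data.List.Relation.Unary.AllPairs using ([]; _∷_)
open import Data.List.Relation.Unary.Unique.Propositional using (Unique)
import Data.List.Relation.Unary.Unique.Propositional.Properties as Unique
open import Data.List.Relation.Unary.Unique.DecPropositional.Properties _≟_ using (deduplicate-!)
open import Data.List.Extrema.Nat using (min; min≤⊤; min≤xs; argmin-sel)
open import Data.Product using (_×_; ∃-syntax; _,_; proj₁; proj₂)
open import Data.Sum using (_⊎_; inj₁; inj₂; [_,_]′)
open import Data.Empty using (⊥; ⊥-elim)
open import Relation.Binary.Definitions using (tri<; tri≈; tri>)
open import Relation.Binary.PropositionalEquality
open import Relation.Nullary using (¬_; ¬?; yes; no)
open import Function.Bundles using (_⇔_; mk⇔; Equivalence)

∈-─ : {A : Set} {x z : A} (ys : List A) (x∈ys : x ∈ ys) → z ∈ ys → z ≢ x → z ∈ (ys ─ x∈ys)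
∈-─ (y ∷ ys) (here refl) (here refl) z≢x = ⊥-elim (z≢x refl)
∈-─ (y ∷ ys) (here _)    (there z∈ys) _  = z∈ys
∈-─ (y ∷ ys) (there _)   (here z≡y)   _  = here z≡y
∈-─ (y ∷ ys) (there x∈ys) (there z∈ys) z≢x = there (∈-─ ys x∈ys z∈ys z≢x)

unique-⊆-length : {A : Set} {xs ys : List A} → Unique xs → xs ⊆ ys → length xs ≤ length ys
unique-⊆-length {xs = []} _ _ = z≤n
unique-⊆-length {xs = x ∷ xs} {ys} (x∉xs ∷ xs!) xs⊆ys = begin
  suc (length xs)          ≤⟨ s≤s (unique-⊆-length xs! xs⊆ys─x) ⟩
  suc (length (ys ─ x∈ys)) ≡⟨ sym (length-removeAt′ ys (index x∈ys)) ⟩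
  length ys                ∎
  where
    open ≤-Reasoning
    x∈ys : x ∈ ys
    x∈ys = xs⊆ys (here refl)
    xs⊆ys─x : xs ⊆ (ys ─ x∈ys)
    xs⊆ys─x z∈xs = ∈-─ ys x∈ys (xs⊆ys (there z∈xs)) (λ z≡x → All.lookup x∉xs z∈xs (sym z≡x))

HasCard-≥ : {A : Set} {S : A → Set} {c : ℕ} → HasCard S c →
            (L : List A) → Unique L → (∀ {z} → z ∈ L → S z) → length L ≤ c
HasCard-≥ (L′ , _ , L′⇔S , refl) L L! L⊆S =
  unique-⊆-length L! (λ z∈L → Equivalence.from (L′⇔S _) (L⊆S z∈L))

HasCard-unique : {A : Set} {S : A → Set} {c d : ℕ} → HasCard S c → HasCard S d → c ≡ d
HasCard-unique hc@(L , L! , L⇔S , refl) hd@(L′ , L′! , L′⇔S , refl) =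
  ≤-antisym (HasCard-≥ hd L L! (λ q → Equivalence.to (L⇔S _) q))
            (HasCard-≥ hc L′ L′! (λ q → Equivalence.to (L′⇔S _) q))

HasCard-⇔ : {A : Set} {S T : A → Set} {c : ℕ} → (∀ x → S x ⇔ T x) → HasCard S c → HasCard T c
HasCard-⇔ S⇔T (L , L! , L⇔S , len) =
  L , L! , (λ x → mk⇔ (λ q → Equivalence.to (S⇔T x) (Equivalence.to (L⇔S x) q))
                      (λ t → Equivalence.from (L⇔S x) (Equivalence.from (S⇔T x) t))) , len

size : List ℕ → ℕ
size A = length (deduplicate _≟_ A)

HasCard-enumerated : {S : ℕ → Set} (L : List ℕ) → (∀ x → x ∈ L ⇔ S x) → HasCard S (size L)
HasCard-enumerated L L⇔S =
  deduplicate _≟_ L , deduplicate-! L ,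
  (λ x → mk⇔ (λ q → Equivalence.to (L⇔S x) (∈-deduplicate⁻ _≟_ L q))
             (λ s → ∈-deduplicate⁺ _≟_ (Equivalence.from (L⇔S x) s))) , refl

HasCard-size : (A : List ℕ) → HasCard ⟦ A ⟧ (size A)
HasCard-size A = HasCard-enumerated A (λ x → mk⇔ (λ q → q) (λ q → q))

sumList : List ℕ → List ℕ → List ℕ
sumList A B = cartesianProductWith _+_ A B

HasCard-sumset : (A B : List ℕ) → HasCard (SumSet A B) (size (sumList A B))
HasCard-sumset A B = HasCard-enumerated (sumList A B) λ x → mk⇔
  (∈-cartesianProductWith⁻ _+_ A B)
  (λ { (a , b , a∈A , b∈B , refl) → ∈-cartesianProductWith⁺ _+_ a∈A b∈B })

SumSet-comm : (A B : List ℕ) → ∀ x → SumSet A B x ⇔ SumSet B A x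
SumSet-comm A B x = mk⇔ swap swap
  where
    swap : {C D : List ℕ} → SumSet C D x → SumSet D C x
    swap (c , d , c∈C , d∈D , x≡c+d) = d , c , d∈D , c∈C , trans x≡c+d (+-comm c d)

HasCard-translate : {A : List ℕ} {k : ℕ} (x : ℕ) → HasCard ⟦ A ⟧ k → HasCard (SumSet A (x ∷ [])) k
HasCard-translate {A} x (L , L! , L⇔A , len) =
  map (_+ x) L , Unique.map⁺ (λ {p} {q} → +-cancelʳ-≡ x p q) L! ,
  (λ z → mk⇔ to from) , trans (length-map (_+ x) L) len
  where
    to : ∀ {z} → z ∈ map (_+ x) L → SumSet A (x ∷ []) z
    to q with ∈-map⁻ (_+ x) q
    ... | y , y∈L , refl = y , x , Equivalence.to (L⇔A y) y∈L , here refl , refl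
    from : ∀ {z} → SumSet A (x ∷ []) z → z ∈ map (_+ x) L
    from (b , _ , b∈A , here refl , refl) = ∈-map⁺ (_+ x) (Equivalence.from (L⇔A b) b∈A)

HasCard-translate′ : {A : List ℕ} {k : ℕ} (x : ℕ) → HasCard ⟦ A ⟧ k → HasCard (SumSet (x ∷ []) A) k
HasCard-translate′ {A} x hA = HasCard-⇔ (SumSet-comm A (x ∷ [])) (HasCard-translate x hA)

IsSingleton : List ℕ → ℕ → Set
IsSingleton A x = ∀ z → z ∈ A ⇔ z ≡ x

size-1-singleton : (A : List ℕ) → size A ≡ 1 → ∃[ x ] IsSingleton A x
size-1-singleton A size≡1 with deduplicate _≟_ A | ∈-deduplicate⁺ _≟_ {A} | ∈-deduplicate⁻ _≟_ A
... | x ∷ [] | into | back = x , λ z → mk⇔ (λ z∈A → only (into z∈A)) (λ { refl → back (here refl) })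
  where
    only : ∀ {z} → z ∈ x ∷ [] → z ≡ x
    only (here z≡x) = z≡x

singleton-sumset : {A B : List ℕ} {x y : ℕ} → IsSingleton A x → IsSingleton B y → HasCard (SumSet A B) 1
singleton-sumset {x = x} {y} A≡x B≡y = (x + y) ∷ [] , [] ∷ [] , (λ z → mk⇔ to from) , refl
  where
    to : ∀ {z} → z ∈ (x + y) ∷ [] → SumSet _ _ z
    to (here refl) = x , y , Equivalence.from (A≡x x) refl , Equivalence.from (B≡y y) refl , refl
    from : ∀ {z} → SumSet _ _ z → z ∈ (x + y) ∷ []
    from (a , b , a∈A , b∈B , refl) =
      here (cong₂ _+_ (Equivalence.to (A≡x a) a∈A) (Equivalence.to (B≡y b) b∈B))

ordered-pair : (D : List ℕ) → Unique D → ∀ {w} → w ∈ D → length D ≢ 1 →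
               ∃[ y₁ ] ∃[ y₂ ] (y₁ ∈ D × y₂ ∈ D × y₁ < y₂)
ordered-pair (x ∷ []) _ _ length≢1 = ⊥-elim (length≢1 refl)
ordered-pair (x ∷ y ∷ _) ((x≢y ∷ _) ∷ _) _ _ with <-cmp x y
... | tri< x<y _ _ = x , y , here refl , there (here refl) , x<y
... | tri≈ _ x≡y _ = ⊥-elim (x≢y x≡y)
... | tri> _ _ y<x = y , x , there (here refl) , here refl , y<x

non-mono-pair : (B : List ℕ) → B ≢ [] → size B ≢ 1 → ∃[ y₁ ] ∃[ y₂ ] (y₁ ∈ B × y₂ ∈ B × y₁ < y₂)
non-mono-pair [] B≢[] _ = ⊥-elim (B≢[] refl)
non-mono-pair B@(b ∷ _) _ size≢1
  with ordered-pair (deduplicate _≟_ B) (deduplicate-! B) (∈-deduplicate⁺ _≟_ {B} (here refl)) size≢1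
... | y₁ , y₂ , y₁∈D , y₂∈D , y₁<y₂ = y₁ , y₂ , ∈-deduplicate⁻ _≟_ B y₁∈D , ∈-deduplicate⁻ _≟_ B y₂∈D , y₁<y₂

-- If A ≠ ∅ and y₁ < y₂ lie in B, then A + B contains the |A| distinct sums
-- a + y₂ and also min A + y₁, which is smaller than all of them.
sumset-grows : (A B : List ℕ) → A ≢ [] → ∀ {y₁ y₂} → y₁ ∈ B → y₂ ∈ B → y₁ < y₂ →
               size A < size (sumList A B)
sumset-grows [] _ A≢[] _ _ _ = ⊥-elim (A≢[] refl)
sumset-grows A@(a₀ ∷ as) B _ {y₁} {y₂} y₁∈B y₂∈B y₁<y₂ =
  subst (_≤ size (sumList A B)) (cong suc (length-map (_+ y₂) D))
    (HasCard-≥ (HasCard-sumset A B) L L! L⊆A+B)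
  where
    D : List ℕ
    D = deduplicate _≟_ A
    μ : ℕ
    μ = min a₀ as
    μ∈A : μ ∈ A
    μ∈A = [ here , there ]′ (argmin-sel (λ z → z) a₀ as)
    μ≤ : ∀ {z} → z ∈ A → μ ≤ z
    μ≤ (here refl) = min≤⊤ a₀ as
    μ≤ (there z∈as) = All.lookup (min≤xs a₀ as) z∈as
    L : List ℕ
    L = (μ + y₁) ∷ map (_+ y₂) D
    L! : Unique L
    L! = All.tabulate below ∷ Unique.map⁺ (λ {p} {q} → +-cancelʳ-≡ y₂ p q) (deduplicate-! A)
      where
        below : ∀ {z} → z ∈ map (_+ y₂) D → μ + y₁ ≢ z
        below q with ∈-map⁻ (_+ y₂) q
        ... | x , x∈D , refl = <⇒≢ (+-mono-≤-< (μ≤ (∈-deduplicate⁻ _≟_ A x∈D)) y₁<y₂)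
    L⊆A+B : ∀ {z} → z ∈ L → SumSet A B z
    L⊆A+B (here refl) = μ , y₁ , μ∈A , y₁∈B , refl
    L⊆A+B (there q) with ∈-map⁻ (_+ y₂) q
    ... | x , x∈D , refl = x , y₂ , ∈-deduplicate⁻ _≟_ A x∈D , y₂∈B , refl

sumset-grows′ : (A B : List ℕ) → B ≢ [] → ∀ {y₁ y₂} → y₁ ∈ A → y₂ ∈ A → y₁ < y₂ →
                size B < size (sumList A B)
sumset-grows′ A B B≢[] y₁∈A y₂∈A y₁<y₂ = subst (size B <_)
  (HasCard-unique (HasCard-⇔ (SumSet-comm B A) (HasCard-sumset B A)) (HasCard-sumset A B))
  (sumset-grows B A B≢[] y₁∈A y₂∈A y₁<y₂)

-- In a weak IASI the two ends of an edge are not both non-mono-indexed: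
-- otherwise |f u + f v| would exceed both |f u| and |f v|.
non-mono-not-adjacent : ∀ {N} {G : Graph N} {f : Fin N → FinSetℕ} → WeakIASI G f →
  ∀ {u v} → G u v → size (f u) ≢ 1 → size (f v) ≢ 1 → ⊥
non-mono-not-adjacent {f = f} W {u} {v} uv fu≢1 fv≢1
  with non-mono-pair (f u) (IASI.nonempty (WeakIASI.iasi W) u) fu≢1
     | non-mono-pair (f v) (IASI.nonempty (WeakIASI.iasi W) v) fv≢1
... | _ , _ , x₁∈fu , x₂∈fu , x₁<x₂ | _ , _ , y₁∈fv , y₂∈fv , y₁<y₂ =
  exceeds-max (WeakIASI.weak W u v uv _ _ _ (HasCard-size (f u)) (HasCard-size (f v)) (HasCard-sumset (f u) (f v)))
    (sumset-grows (f u) (f v) (nonempty u) y₁∈fv y₂∈fv y₁<y₂)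
    (sumset-grows′ (f u) (f v) (nonempty v) x₁∈fu x₂∈fu x₁<x₂)
  where
    nonempty : ∀ w → f w ≢ []
    nonempty = IASI.nonempty (WeakIASI.iasi W)
    exceeds-max : ∀ {s t c} → c ≡ s ⊔ t → s < c → t < c → ⊥
    exceeds-max {s} {t} refl s<c t<c =
      [ (λ e → <-irrefl (sym e) s<c) , (λ e → <-irrefl (sym e) t<c) ]′ (⊔-sel s t)

pairs : (M : ℕ) → List (Fin M × Fin M)
pairs zero = []
pairs (suc M) = map (λ j → fzero , fsuc j) (allFin M) ++ map (λ p → fsuc (proj₁ p) , fsuc (proj₂ p)) (pairs M)

triangle : ℕ → ℕ
triangle zero = 0
triangle (suc M) = M + triangle M

pairs-length : ∀ M → length (pairs M) ≡ triangle M
pairs-length zero = refl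
pairs-length (suc M) = begin
  length (map _ (allFin M) ++ map _ (pairs M))         ≡⟨ length-++ (map (λ j → fzero {M} , fsuc j) (allFin M)) ⟩
  length (map _ (allFin M)) + length (map _ (pairs M)) ≡⟨ cong₂ _+_ (length-map _ (allFin M)) (length-map _ (pairs M)) ⟩
  length (allFin M) + length (pairs M)                 ≡⟨ cong₂ _+_ (length-tabulate {n = M} (λ i → i)) (pairs-length M) ⟩
  M + triangle M                                       ∎
  where open ≡-Reasoning

pairs-sound : ∀ {M} {i j : Fin M} → (i , j) ∈ pairs M → i <ᶠ j
pairs-sound {suc M} q with ∈-++⁻ (map (λ j → fzero {M} , fsuc j) (allFin M)) q
... | inj₁ q₁ with ∈-map⁻ (λ j → fzero {M} , fsuc j) q₁
...   | _ , _ , refl = s≤s z≤n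
pairs-sound {suc M} q | inj₂ q₂ with ∈-map⁻ (λ p → fsuc (proj₁ p) , fsuc (proj₂ p)) q₂
...   | _ , r , refl = s≤s (pairs-sound r)

pairs-complete : ∀ {M} (i j : Fin M) → i <ᶠ j → (i , j) ∈ pairs M
pairs-complete {suc M} fzero (fsuc j) _ = ∈-++⁺ˡ (∈-map⁺ (λ j → fzero {M} , fsuc j) (∈-allFin j))
pairs-complete {suc M} (fsuc i) (fsuc j) (s≤s i<j) =
  ∈-++⁺ʳ (map (λ j → fzero {M} , fsuc j) (allFin M))
         (∈-map⁺ (λ p → fsuc (proj₁ p) , fsuc (proj₂ p)) (pairs-complete i j i<j))

pair-injective : {A B : Set} {g : A → B} → (∀ {x y} → g x ≡ g y → x ≡ y) →
  ∀ {p q : A × A} → (g (proj₁ p) , g (proj₂ p)) ≡ (g (proj₁ q) , g (proj₂ q)) → p ≡ q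
pair-injective g-inj {_ , _} {_ , _} e = cong₂ _,_ (g-inj (cong proj₁ e)) (g-inj (cong proj₂ e))

pairs-unique : ∀ M → Unique (pairs M)
pairs-unique zero = []
pairs-unique (suc M) =
  Unique.++⁺ (Unique.map⁺ (λ e → fsuc-injective (cong proj₂ e)) (Unique.allFin⁺ M))
                (Unique.map⁺ (pair-injective fsuc-injective) (pairs-unique M))
                disjoint
  where
    disjoint : ∀ {v} → ¬ (v ∈ map (λ j → fzero {M} , fsuc j) (allFin M) ×
                          v ∈ map (λ p → fsuc (proj₁ p) , fsuc (proj₂ p)) (pairs M))
    disjoint (q₁ , q₂) with ∈-map⁻ (λ j → fzero {M} , fsuc j) q₁ | ∈-map⁻ (λ p → fsuc (proj₁ p) , fsuc (proj₂ p)) q₂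
    ... | _ , _ , refl | _ , _ , ()

triangle-double : ∀ M → triangle M * 2 ≡ M * (M ∸ 1)
triangle-double zero = refl
triangle-double (suc zero) = refl
triangle-double (suc (suc K)) = begin
  (suc K + triangle (suc K)) * 2    ≡⟨ *-distribʳ-+ 2 (suc K) (triangle (suc K)) ⟩
  suc K * 2 + triangle (suc K) * 2  ≡⟨ cong (suc K * 2 +_) (triangle-double (suc K)) ⟩
  suc K * 2 + suc K * K             ≡⟨ sym (*-distribˡ-+ (suc K) 2 K) ⟩
  suc K * (2 + K)                   ≡⟨ *-comm (suc K) (2 + K) ⟩
  suc (suc K) * suc K               ∎
  where open ≡-Reasoning

triangle-formula : ∀ M → triangle M ≡ (M * (M ∸ 1)) / 2
triangle-formula M = trans (sym (m*n/n≡m (triangle M) 2)) (cong (_/ 2) (triangle-double M))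

-- A Sidon sequence: a k = 2^k - 1

a : ℕ → ℕ
a zero = 0
a (suc k) = suc (a k + a k)

a-mono : ∀ {i j} → i ≤ j → a i ≤ a j
a-mono {zero} _ = z≤n
a-mono {suc i} {suc j} (s≤s i≤j) = s≤s (+-mono-≤ (a-mono i≤j) (a-mono i≤j))

a-dominates : ∀ {i j l} → i < l → j < l → a i + a j < a l
a-dominates {l = suc l} (s≤s i≤l) (s≤s j≤l) = s≤s (+-mono-≤ (a-mono i≤l) (a-mono j≤l))

a-injective : ∀ {i j} → a i ≡ a j → i ≡ j
a-injective {i} {j} e with <-cmp i j
... | tri< i<j _ _ = ⊥-elim (<⇒≢ (≤-<-trans (m≤m+n (a i) (a i)) (a-dominates i<j i<j)) e)
... | tri≈ _ i≡j _ = i≡j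
... | tri> _ _ j<i = ⊥-elim (<⇒≢ (≤-<-trans (m≤m+n (a j) (a j)) (a-dominates j<i j<i)) (sym e))

-- Sums of two distinct terms determine the terms: the larger index is
-- forced by dominance, then the smaller one by injectivity.
a-sidon : ∀ {i j k l} → i < j → k < l → a i + a j ≡ a k + a l → i ≡ k × j ≡ l
a-sidon {i} {j} {k} {l} i<j k<l e with <-cmp j l
... | tri< j<l _ _ = ⊥-elim (<⇒≢ (<-≤-trans (a-dominates (<-trans i<j j<l) j<l) (m≤n+m (a l) (a k))) e)
... | tri> _ _ l<j = ⊥-elim (<⇒≢ (<-≤-trans (a-dominates (<-trans k<l l<j) l<j) (m≤n+m (a j) (a i))) (sym e))
... | tri≈ _ refl _ = a-injective (+-cancelʳ-≡ (a j) (a i) (a k) e) , refl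

least-unique : {S T : ℕ → Set} (p q : ℕ) → S p → T q → (∀ {z} → S z → p ≤ z) → (∀ {z} → T z → q ≤ z) →
               (∀ x → S x ⇔ T x) → p ≡ q
least-unique p q Sp Tq p≤S q≤T S⇔T =
  ≤-antisym (p≤S (Equivalence.from (S⇔T q) Tq)) (q≤T (Equivalence.to (S⇔T p) Sp))

module CompleteGraph (M : ℕ) (G : Graph (suc M))
    (complete : ∀ u v → u ≢ v → G u v) (loopless : ∀ u v → G u v → u ≢ v) where

  MonoEdge : (Fin (suc M) → FinSetℕ) → Fin (suc M) × Fin (suc M) → Set
  MonoEdge f e = IsEdge G e × HasCard (SumSet (f (proj₁ e)) (f (proj₂ e))) 1

  mono-except-one : (f : Fin (suc M) → FinSetℕ) → WeakIASI G f →
                    ∃[ w ] (∀ u → u ≢ w → size (f u) ≡ 1)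
  mono-except-one f W with any? (λ u → ¬? (size (f u) ≟ 1))
  ... | yes (w , fw≢1) = w , mono
    where
      mono : ∀ u → u ≢ w → size (f u) ≡ 1
      mono u u≢w with size (f u) ≟ 1
      ... | yes fu≡1 = fu≡1
      ... | no fu≢1 = ⊥-elim (non-mono-not-adjacent W (complete u w u≢w) fu≢1 fw≢1)
  ... | no none = fzero , λ u _ → mono u
    where
      mono : ∀ u → size (f u) ≡ 1
      mono u with size (f u) ≟ 1
      ... | yes fu≡1 = fu≡1
      ... | no fu≢1 = ⊥-elim (none (u , fu≢1))

  punchIn-< : ∀ w (i j : Fin M) → i <ᶠ j → punchIn w i <ᶠ punchIn w j
  punchIn-< w i j i<j = ≤∧≢⇒< (punchIn-mono-≤ w i j (<⇒≤ i<j))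
    (λ e → <⇒≢ i<j (cong toℕ (punchIn-injective w i j (toℕ-injective e))))

  -- The triangle M edges among the vertices other than w are all mono-indexed.
  sparing-lower : ∀ f → WeakIASI G f → ∀ k → MonoEdgeCount G f k → triangle M ≤ k
  sparing-lower f W k count with mono-except-one f W
  ... | w , mono = subst (_≤ k) (trans (length-map avoid (pairs M)) (pairs-length M))
                     (HasCard-≥ count (map avoid (pairs M)) avoid-unique avoid-mono)
    where
      avoid : Fin M × Fin M → Fin (suc M) × Fin (suc M)
      avoid (i , j) = punchIn w i , punchIn w j
      avoid-unique : Unique (map avoid (pairs M))
      avoid-unique = Unique.map⁺ (pair-injective (punchIn-injective w _ _)) (pairs-unique M)
      singleton : ∀ i → ∃[ x ] IsSingleton (f (punchIn w i)) x
      singleton i = size-1-singleton (f (punchIn w i)) (mono _ (punchInᵢ≢i w i))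
      avoid-mono : ∀ {e} → e ∈ map avoid (pairs M) → MonoEdge f e
      avoid-mono q with ∈-map⁻ avoid q
      ... | (i , j) , ij∈pairs , refl =
        let i<j = punchIn-< w i j (pairs-sound ij∈pairs) in
        (i<j , complete _ _ (λ e → <⇒≢ i<j (cong toℕ e))) ,
        singleton-sumset (proj₂ (singleton i)) (proj₂ (singleton j))

  α : Fin (suc M) → ℕ
  α u = a (toℕ u)

  label : Fin (suc M) → FinSetℕ
  label fzero = 0 ∷ 1 ∷ []
  label (fsuc i) = α (fsuc i) ∷ []

  α∈label : ∀ u → α u ∈ label u
  α∈label fzero = here refl
  α∈label (fsuc i) = here refl

  α≤label : ∀ u {z} → z ∈ label u → α u ≤ z
  α≤label fzero _ = z≤n
  α≤label (fsuc i) (here refl) = ≤-refl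

  α≤sumset : ∀ u v {z} → SumSet (label u) (label v) z → α u + α v ≤ z
  α≤sumset u v (_ , _ , b∈u , c∈v , refl) = +-mono-≤ (α≤label u b∈u) (α≤label v c∈v)

  ≢⇒<⊎> : ∀ {u v : Fin (suc M)} → u ≢ v → (toℕ u < toℕ v) ⊎ (toℕ v < toℕ u)
  ≢⇒<⊎> {u} {v} u≢v with <-cmp (toℕ u) (toℕ v)
  ... | tri< u<v _ _ = inj₁ u<v
  ... | tri≈ _ e _ = ⊥-elim (u≢v (toℕ-injective e))
  ... | tri> _ _ v<u = inj₂ v<u

  α-sidon : ∀ {u v u′ v′} → u ≢ v → u′ ≢ v′ → α u + α v ≡ α u′ + α v′ →
            (u ≡ u′ × v ≡ v′) ⊎ (u ≡ v′ × v ≡ u′)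
  α-sidon {u} {v} {u′} {v′} u≢v u′≢v′ e with ≢⇒<⊎> u≢v | ≢⇒<⊎> u′≢v′
  ... | inj₁ p | inj₁ q = let (x , y) = a-sidon p q e in
    inj₁ (toℕ-injective x , toℕ-injective y)
  ... | inj₁ p | inj₂ q = let (x , y) = a-sidon p q (trans e (+-comm (α u′) (α v′))) in
    inj₂ (toℕ-injective x , toℕ-injective y)
  ... | inj₂ p | inj₁ q = let (x , y) = a-sidon p q (trans (+-comm (α v) (α u)) e) in
    inj₂ (toℕ-injective y , toℕ-injective x)
  ... | inj₂ p | inj₂ q = let (x , y) = a-sidon p q (trans (+-comm (α v) (α u)) (trans e (+-comm (α u′) (α v′)))) in
    inj₁ (toℕ-injective y , toℕ-injective x)

  -- Least elements recover vertices from labels, and edges from sumsets.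
  label-iasi : IASI G label
  label-iasi = record
    { nonempty = λ { fzero () ; (fsuc _) () }
    ; injective = λ u v e → toℕ-injective (a-injective
        (least-unique (α u) (α v) (α∈label u) (α∈label v) (α≤label u) (α≤label v) e))
    ; edge-injective = λ u v u′ v′ uv u′v′ e → α-sidon (loopless u v uv) (loopless u′ v′ u′v′)
        (least-unique (α u + α v) (α u′ + α v′)
          (α u , α v , α∈label u , α∈label v , refl) (α u′ , α v′ , α∈label u′ , α∈label v′ , refl)
          (α≤sumset u v) (α≤sumset u′ v′) e)
    }

  labelSize : Fin (suc M) → ℕ
  labelSize fzero = 2
  labelSize (fsuc _) = 1

  HasCard-label : ∀ u → HasCard ⟦ label u ⟧ (labelSize u)
  HasCard-label fzero = label fzero , ((λ ()) ∷ []) ∷ [] ∷ [] , (λ _ → mk⇔ (λ q → q) (λ q → q)) , refl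
  HasCard-label (fsuc i) = label (fsuc i) , [] ∷ [] , (λ _ → mk⇔ (λ q → q) (λ q → q)) , refl

  labelSize≡⊔1 : ∀ u → labelSize u ≡ labelSize u ⊔ 1
  labelSize≡⊔1 fzero = refl
  labelSize≡⊔1 (fsuc _) = refl

  -- Every edge has a singleton end, so its sumset is a translate of the other label.
  label-weak : ∀ u v → G u v → ∀ a′ b c → HasCard ⟦ label u ⟧ a′ → HasCard ⟦ label v ⟧ b →
               HasCard (SumSet (label u) (label v)) c → c ≡ a′ ⊔ b
  label-weak u (fsuc j) _ a′ b c ha hb hc = begin
    c                                     ≡⟨ HasCard-unique hc (HasCard-translate (α (fsuc j)) (HasCard-label u)) ⟩
    labelSize u                           ≡⟨ labelSize≡⊔1 u ⟩
    labelSize u ⊔ 1                       ≡⟨ sym (cong₂ _⊔_ (HasCard-unique ha (HasCard-label u)) (HasCard-unique hb (HasCard-label (fsuc j)))) ⟩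
    a′ ⊔ b                                ∎
    where open ≡-Reasoning
  label-weak (fsuc i) fzero _ a′ b c ha hb hc = begin
    c                                     ≡⟨ HasCard-unique hc (HasCard-translate′ (α (fsuc i)) (HasCard-label fzero)) ⟩
    1 ⊔ 2                                 ≡⟨ sym (cong₂ _⊔_ (HasCard-unique ha (HasCard-label (fsuc i))) (HasCard-unique hb (HasCard-label fzero))) ⟩
    a′ ⊔ b                                ∎
    where open ≡-Reasoning
  label-weak fzero fzero uv _ _ _ _ _ _ = ⊥-elim (loopless _ _ uv refl)

  label-weakIASI : WeakIASI G label
  label-weakIASI = record { iasi = label-iasi ; weak = label-weak }

  label-mono : MonoEdgeCount G label (triangle M)
  label-mono = map shift (pairs M) , Unique.map⁺ (pair-injective fsuc-injective) (pairs-unique M) ,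
               (λ e → mk⇔ shifted-mono (mono-shifted e)) ,
               trans (length-map shift (pairs M)) (pairs-length M)
    where
      shift : Fin M × Fin M → Fin (suc M) × Fin (suc M)
      shift (i , j) = fsuc i , fsuc j
      singleton : ∀ u → IsSingleton (α u ∷ []) (α u)
      singleton u z = mk⇔ (λ { (here z≡αu) → z≡αu }) (λ { refl → here refl })
      shifted-mono : ∀ {e} → e ∈ map shift (pairs M) → MonoEdge label e
      shifted-mono q with ∈-map⁻ shift q
      ... | (i , j) , ij∈pairs , refl =
        (s≤s (pairs-sound ij∈pairs) , complete _ _ (λ e → <⇒≢ (pairs-sound ij∈pairs) (cong toℕ (fsuc-injective e)))) ,
        singleton-sumset (singleton (fsuc i)) (singleton (fsuc j))
      two≢one : 2 ≢ 1
      two≢one ()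
      mono-shifted : ∀ e → MonoEdge label e → e ∈ map shift (pairs M)
      mono-shifted (_ , fzero) ((() , _) , _)
      mono-shifted (fzero , fsuc j) (_ , mono) =
        ⊥-elim (two≢one (HasCard-unique (HasCard-translate (α (fsuc j)) (HasCard-label fzero)) mono))
      mono-shifted (fsuc i , fsuc j) ((s≤s i<j , _) , _) = ∈-map⁺ shift (pairs-complete i j i<j)

  sparing : IsSparingNumber G (triangle M)
  sparing = (label , label-weakIASI , label-mono) , sparing-lower

-- Vertices in the same part are joined through a vertex of the other part.
power-complete : ∀ m n r → 1 ≤ m → 1 ≤ n → 1 < r → ∀ u v → u ≢ v → Power (K m n) r u v
power-complete m n r 1≤m 1≤n 1<r u v u≢v = u≢v , walk
  where
    right : Fin (m + n)
    right = fromℕ< (m<m+n m 1≤n)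
    m≤right : m ≤ toℕ right
    m≤right = ≤-reflexive (sym (toℕ-fromℕ< (m<m+n m 1≤n)))
    left : Fin (m + n)
    left = fromℕ< (≤-trans 1≤m (m≤m+n m n))
    left<m : toℕ left < m
    left<m = subst (_< m) (sym (toℕ-fromℕ< (≤-trans 1≤m (m≤m+n m n)))) 1≤m
    walk : ∃[ ℓ ] (ℓ ≤ r × Walk (K m n) u v ℓ)
    walk with toℕ u <? m | m ≤? toℕ v
    ... | yes u<m | yes m≤v = 1 , <⇒≤ 1<r , step (inj₁ (u<m , m≤v)) here
    ... | yes u<m | no m≰v  = 2 , 1<r , step (inj₁ (u<m , m≤right)) (step (inj₂ (m≤right , ≰⇒> m≰v)) here)
    ... | no u≮m  | no m≰v  = 1 , <⇒≤ 1<r , step (inj₂ (≮⇒≥ u≮m , ≰⇒> m≰v)) here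
    ... | no u≮m  | yes m≤v = 2 , 1<r , step (inj₂ (≮⇒≥ u≮m , left<m)) (step (inj₁ (left<m , m≤v)) here)

mainTheorem10 : (m n : ℕ) → 1 ≤ m → 1 ≤ n → (r : ℕ) → 1 < r →
    IsSparingNumber (Power (K m n) r) (((m + n ∸ 1) * (m + n ∸ 2)) / 2)
mainTheorem10 (suc m′) n 1≤m 1≤n r 1<r =
  subst (IsSparingNumber (Power (K (suc m′) n) r)) (triangle-formula (m′ + n))
    (CompleteGraph.sparing (m′ + n) (Power (K (suc m′) n) r)
      (power-complete (suc m′) n r 1≤m 1≤n 1<r) (λ u v uv → proj₁ uv))
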